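{- Let $k\ge1$ be an integer. Let $\omega_C$ be the maximal element (for the right weak order) of an $\equiv_k$ class $C$ of $\mathfrak S_n$. Then the interval $[\mathrm{id},\omega_C]$ of the right weak order, where $\mathrm{id}$ is the identity permutation, is a union of $\equiv_k$ classes. Moreover, if $\alpha_C$ is the minimal element (for the right weak order) of an $\equiv_k$ class $C$ and $\omega$ is the maximal permutation $n(n-1)\cdots1$, then the interval $[\alpha_C,\omega]$ of the right weak order is a union of $\equiv_k$ classes.
   Context: For $\pi\in\mathfrak S_n$, extend $\pi$ to a bijection of $\mathbb Z$ by $\pi(j)=j$ for $j\notin[1,n]$, and let $\mathrm{DC}_k(\pi)=d_1\cdots d_n$ with $d_i=1+\#\{j: i-k+1\le j\le i-1,\ \pi(j)<\pi(i)\}$; set $\mathrm{RC}_k(\pi)=\mathrm{DC}_k(\pi^{ -1})$, and $\sigma\equiv_k\tau$ iff $\mathrm{RC}_k(\sigma)=\mathrm{RC}_k(\tau)$. The right weak order on $\mathfrak S_n$: $\sigma\le_R\tau$ iff the inversion set $\{(a,b):a<b,\ b\text{ appears left of }a\}$ of $\sigma$ is contained in that of $\tau$. Each $\equiv_k$ class is an interval of the right weak order, so it has a minimum $\alpha_C$ and a maximum $\omega_C$. -}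

module Defs where

open import Data.Nat as ℕ using (ℕ; suc)
open import Data.Fin as Fin using (Fin; toℕ; fromℕ<)
open import Data.Fin.Permutation using (Permutation′; _⟨$⟩ʳ_; _⟨$⟩ˡ_; flip)
open import Data.Integer as ℤ using (ℤ; +_; _-_; _<?_; _≤?_)
open import Data.List using (List; []; _∷_; map; filter; length; upTo)
open import Data.Product using (_×_)
open import Relation.Nullary.Decidable using (yes; no; _×-dec_)
open import Relation.Binary.PropositionalEquality using (_≡_)

-- Permutations of [1,n], represented on Fin n (value/position i ↔ toℕ i + 1).
Perm : ℕ → Set
Perm n = Permutation′ n

ext : ∀ {n} → Perm n → ℤ → ℤ
ext {n} π j with (+ 1 ℤ.≤? j) ×-dec (j ℤ.≤? + n)
... | no _ = j
... | yes _ with ℕ.pred (ℤ.∣ j ∣) ℕ.<? n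
...   | yes p = + suc (toℕ (π ⟨$⟩ʳ fromℕ< p))
...   | no _  = j

-- DC_k(π) = d_1 ⋯ d_n, d_i = 1 + #{ j : i-k+1 ≤ j ≤ i-1, π(j) < π(i) }
-- (the window j = i - t, t = 1 … k-1, over ℤ).
DC : ℕ → ∀ {n} → Perm n → Fin n → ℕ
DC k π i = suc (length (filter (λ j → ext π j ℤ.<? ext π ipos) window))
  where
  ipos : ℤ
  ipos = + suc (toℕ i)
  window : List ℤ
  window = map (λ t → ipos - + suc t) (upTo (k ℕ.∸ 1))

RC : ℕ → ∀ {n} → Perm n → Fin n → ℕ
RC k π = DC k (flip π)

_≡[_]_ : ∀ {n} → Perm n → ℕ → Perm n → Set
σ ≡[ k ] τ = ∀ i → RC k σ i ≡ RC k τ i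

-- position of value a in the one-line word of σ is σ⁻¹(a)
-- Inv σ a b : a < b and b appears left of a in σ
Inv : ∀ {n} → Perm n → Fin n → Fin n → Set
Inv σ a b = (a Fin.< b) × ((σ ⟨$⟩ˡ b) Fin.< (σ ⟨$⟩ˡ a))

_≤R_ : ∀ {n} → Perm n → Perm n → Set
σ ≤R τ = ∀ a b → Inv σ a b → Inv τ a b

-- σ ≡[ k ] τ holds exactly when σ and τ put every pair of values at distance less than k in the
-- same order. One direction is a direct count. For the other, induct on the larger value b of a
-- pair: if τ moved a from the left of b to its right, equality of the b-th entries of RC forces
-- another window value c to move the other way, and the pair (a, c) contradicts the induction
-- hypothesis.
--
-- In the maximum ω of a class, adjacent entries forming an ascent are at distance less than k:
-- otherwise swapping them stays in the class and creates an inversion that ω lacks. So whenever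
-- a < b and a is left of b in ω, a is linked to b by a chain of ascending pairs at distance less
-- than k, each ordered alike in ω, in every σ ≤R ω, and in every τ ≡[ k ] σ; hence τ ≤R ω. For
-- the minimum the same argument runs on descents, with the values mirrored.

module Submission where

open import Defs
open import Data.Nat as ℕ
  using (ℕ; zero; suc; _+_; _∸_; _<_; _≤_; _≥_; z≤n; s≤s; s<s; s≤s⁻¹; s<s⁻¹)
open import Data.Nat.Properties
open import Data.Fin as Fin using (Fin; toℕ; fromℕ<; opposite)
open import Data.Fin.Properties
  using (toℕ<n; toℕ-fromℕ<; fromℕ<-toℕ; toℕ-injective; opposite-prop; opposite-involutive)
open import Data.Fin.Permutation
  using (id; reverse; transpose; flip; _⟨$⟩ʳ_; _⟨$⟩ˡ_; _∘ₚ_; inverseˡ; inverseʳ)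
import Data.Fin.Permutation.Components as PC
open import Data.Integer as ℤ using (ℤ; +_; _-_)
import Data.Integer.Properties as ℤ
open import Data.List using (List; []; _∷_; map; filter; length; upTo)
open import Data.List.Relation.Unary.All as All using (All; []; _∷_)
import Data.List.Relation.Unary.All.Properties as Allₚ
open import Data.List.Relation.Unary.Any using (Any; here; there; any?)
import Data.List.Relation.Unary.Any.Properties as Anyₚ
open import Data.List.Membership.Propositional using (find; lose)
open import Data.List.Membership.Propositional.Properties using (∈-upTo⁺; ∈-upTo⁻)
open import Data.Product using (_×_; _,_; proj₁; proj₂; ∃)
open import Data.Sum using (inj₁; inj₂)
open import Function.Base using (_∘_)
open import Function.Bundles using (_⇔_; mk⇔; module Equivalence)
open import Function.Construct.Composition using (_⇔-∘_)
open import Function.Construct.Symmetry using (⇔-sym)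
open import Level using (Level)
open import Relation.Binary.Definitions using (Symmetric; tri<; tri≈; tri>)
open import Relation.Nullary using (¬_; Dec; yes; no; contradiction)
open import Relation.Nullary.Decidable using (_×-dec_; ¬?; dec-true; dec-false; decidable-stable)
open import Relation.Unary using (Pred; Decidable)
open import Relation.Binary.PropositionalEquality

open Equivalence using (to; from)

module _ {a p q : Level} {A : Set a} {P : Pred A p} {Q : Pred A q}
         (P? : Decidable P) (Q? : Decidable Q) where

  length-filter-cong : ∀ {xs} → All (λ x → P x ⇔ Q x) xs →
                       length (filter P? xs) ≡ length (filter Q? xs)
  length-filter-cong {[]} [] = refl
  length-filter-cong {x ∷ xs} (P⇔Q ∷ rest) with P? x | Q? x
  ... | yes px | yes qx = cong suc (length-filter-cong rest)
  ... | no _   | no _   = length-filter-cong rest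
  ... | yes px | no ¬qx = contradiction (to P⇔Q px) ¬qx
  ... | no ¬px | yes qx = contradiction (from P⇔Q qx) ¬px

  length-filter-mono : ∀ {xs} → All (λ x → Q x → P x) xs →
                       length (filter Q? xs) ≤ length (filter P? xs)
  length-filter-mono {[]} [] = z≤n
  length-filter-mono {x ∷ xs} (Q⇒P ∷ rest) with P? x | Q? x
  ... | yes _ | yes _ = s≤s (length-filter-mono rest)
  ... | yes _ | no _  = m≤n⇒m≤1+n (length-filter-mono rest)
  ... | no _  | no _  = length-filter-mono rest
  ... | no ¬px | yes qx = contradiction (Q⇒P qx) ¬px

  length-filter-mono-< : ∀ {xs} → All (λ x → Q x → P x) xs → Any (λ x → P x × ¬ Q x) xs →
                         length (filter Q? xs) < length (filter P? xs)
  length-filter-mono-< {x ∷ xs} (Q⇒P ∷ rest) p∖q with P? x | Q? x | p∖q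
  ... | yes _ | yes _ | there p∖q′ = s<s (length-filter-mono-< rest p∖q′)
  ... | yes _ | no _  | _          = s≤s (length-filter-mono rest)
  ... | no _  | no _  | there p∖q′ = length-filter-mono-< rest p∖q′
  ... | no ¬px | yes qx | _          = contradiction (Q⇒P qx) ¬px
  ... | _     | yes qx | here (_ , ¬qx) = contradiction qx ¬qx
  ... | no ¬px | _     | here (px , _) = contradiction px ¬px

  length-filter-exchange : ∀ xs → length (filter P? xs) ≡ length (filter Q? xs) →
                           Any (λ x → P x × ¬ Q x) xs → Any (λ x → Q x × ¬ P x) xs
  length-filter-exchange xs eq p∖q with any? (λ x → Q? x ×-dec ¬? (P? x)) xs
  ... | yes q∖p = q∖p
  ... | no ¬q∖p = contradiction (sym eq) (<⇒≢ (length-filter-mono-< Q⇒P p∖q))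
    where
    Q⇒P : All (λ x → Q x → P x) xs
    Q⇒P = All.map (λ ¬[qx×¬px] qx → decidable-stable (P? _) (λ ¬px → ¬[qx×¬px] (qx , ¬px)))
                  (Allₚ.¬Any⇒All¬ xs ¬q∖p)

private
  variable
    n k : ℕ
    σ τ ω α ρ : Perm n

pos : Perm n → Fin n → ℕ
pos σ v = toℕ (σ ⟨$⟩ˡ v)

Before : Perm n → Fin n → Fin n → Set
Before σ u v = pos σ u < pos σ v

pos-injective : ∀ (σ : Perm n) {u v} → pos σ u ≡ pos σ v → u ≡ v
pos-injective σ {u} {v} eq = begin
  u                          ≡⟨ inverseʳ σ ⟨
  σ ⟨$⟩ʳ (σ ⟨$⟩ˡ u)          ≡⟨ cong (σ ⟨$⟩ʳ_) (toℕ-injective eq) ⟩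
  σ ⟨$⟩ʳ (σ ⟨$⟩ˡ v)          ≡⟨ inverseʳ σ ⟩
  v                          ∎
  where open ≡-Reasoning

pos<n : ∀ (σ : Perm n) v → pos σ v < n
pos<n σ v = toℕ<n (σ ⟨$⟩ˡ v)

valueAt : ∀ (σ : Perm n) q → q < n → ∃ λ v → pos σ v ≡ q
valueAt σ q q<n = σ ⟨$⟩ʳ fromℕ< q<n , trans (cong toℕ (inverseˡ σ)) (toℕ-fromℕ< q<n)

before-connex : ∀ (σ : Perm n) {u v} → u ≢ v → ¬ Before σ u v → Before σ v u
before-connex σ u≢v ¬uv = ≤∧≢⇒< (≮⇒≥ ¬uv) (λ eq → u≢v (pos-injective σ (sym eq)))

before-transfer : ∀ (σ τ : Perm n) {u v} →
                  (Before τ v u → Before σ v u) → Before σ u v → Before τ u v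
before-transfer σ τ {u} {v} reflect σuv with pos τ u ℕ.<? pos τ v
... | yes τuv = τuv
... | no ¬τuv = contradiction (reflect (before-connex τ u≢v ¬τuv)) (<-asym σuv)
  where
  u≢v : u ≢ v
  u≢v refl = <-irrefl refl σuv

Near : ℕ → Fin n → Fin n → Set
Near k u v = toℕ u < toℕ v + k × toℕ v < toℕ u + k

near-sym : Symmetric (Near {n} k)
near-sym (u<v+k , v<u+k) = v<u+k , u<v+k

near-< : ∀ {u v : Fin n} → toℕ u < toℕ v → toℕ v < toℕ u + k → Near k u v
near-< u<v v<u+k = <-≤-trans u<v (m≤m+n _ _) , v<u+k

KeepsOrderOn : (Fin n → Fin n → Set) → Perm n → Perm n → Set
KeepsOrderOn R σ τ = ∀ u v → R u v → Before σ u v → Before τ u v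

KeepsNearOrder : ℕ → Perm n → Perm n → Set
KeepsNearOrder k = KeepsOrderOn (Near k)

keepsOrderOn-sym : ∀ {R : Fin n → Fin n → Set} → Symmetric R →
                   KeepsOrderOn R σ τ → KeepsOrderOn R τ σ
keepsOrderOn-sym {σ = σ} {τ} R-sym keep u v r = before-transfer τ σ (keep v u (R-sym r))

≡[]-sym : σ ≡[ k ] τ → τ ≡[ k ] σ
≡[]-sym σ≡τ i = sym (σ≡τ i)

≡[]-trans : σ ≡[ k ] τ → τ ≡[ k ] ρ → σ ≡[ k ] ρ
≡[]-trans σ≡τ τ≡ρ i = trans (σ≡τ i) (τ≡ρ i)

-- RC k σ i counts the entries of window k i, the values i − 1, …, i − k + 1 shifted to 1-based
-- integers, that σ places left of i; entries ≤ 0 are fixed by ext and always count.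
windowEntry : Fin n → ℕ → ℤ
windowEntry i t = + suc (toℕ i) - + suc t

LeftOf : Perm n → Fin n → ℤ → Set
LeftOf σ i j = ext (flip σ) j ℤ.< ext (flip σ) (+ suc (toℕ i))

leftOf? : ∀ (σ : Perm n) i → Decidable (LeftOf σ i)
leftOf? σ i j = ext (flip σ) j ℤ.<? ext (flip σ) (+ suc (toℕ i))

window : ℕ → Fin n → List ℤ
window k i = map (windowEntry i) (upTo (k ∸ 1))

ext-inside : ∀ (π : Perm n) v → ext π (+ suc (toℕ v)) ≡ + suc (toℕ (π ⟨$⟩ʳ v))
ext-inside {n} π v with (+ 1 ℤ.≤? + suc (toℕ v)) ×-dec (+ suc (toℕ v) ℤ.≤? + n)
... | no ¬inside = contradiction (ℤ.+≤+ (s≤s z≤n) , ℤ.+≤+ (toℕ<n v)) ¬inside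
... | yes _ with toℕ v ℕ.<? n
...   | yes v<n = cong (λ w → + suc (toℕ (π ⟨$⟩ʳ w))) (fromℕ<-toℕ v v<n)
...   | no v≮n  = contradiction (toℕ<n v) v≮n

ext-nonpositive : ∀ (π : Perm n) m → ext π (ℤ.- + m) ≡ ℤ.- + m
ext-nonpositive π zero    = refl
ext-nonpositive π (suc m) = refl

windowEntry-inside : ∀ {v i : Fin n} t → toℕ v + suc t ≡ toℕ i → windowEntry i t ≡ + suc (toℕ v)
windowEntry-inside {v = v} {i} t v+t+1≡i = begin
  suc (toℕ i) ℤ.⊖ suc t            ≡⟨ ℤ.⊖-≥ (m≤n⇒m≤1+n t+1≤i) ⟩
  + (suc (toℕ i) ∸ suc t)          ≡⟨ cong (λ m → + (suc m ∸ suc t)) v+t+1≡i ⟨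
  + (suc (toℕ v + suc t) ∸ suc t)  ≡⟨ cong +_ (m+n∸n≡m (suc (toℕ v)) (suc t)) ⟩
  + suc (toℕ v)                    ∎
  where
  open ≡-Reasoning
  t+1≤i : suc t ≤ toℕ i
  t+1≤i = subst (suc t ≤_) v+t+1≡i (m≤n+m (suc t) (toℕ v))

leftOf-inside : ∀ (σ : Perm n) {v i} t → toℕ v + suc t ≡ toℕ i →
                LeftOf σ i (windowEntry i t) ⇔ Before σ v i
leftOf-inside σ {v} {i} t eq
  rewrite windowEntry-inside t eq | ext-inside (flip σ) v | ext-inside (flip σ) i =
  mk⇔ (λ { (ℤ.+<+ (s<s vi)) → vi }) (λ vi → ℤ.+<+ (s<s vi))

leftOf-outside : ∀ (σ : Perm n) {i} t → toℕ i ≤ t → LeftOf σ i (windowEntry i t)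
leftOf-outside σ {i} t i≤t
  rewrite ℤ.⊖-≤ (s≤s i≤t) | ext-nonpositive (flip σ) (t ∸ toℕ i) | ext-inside (flip σ) i =
  nonpositive<positive (t ∸ toℕ i)
  where
  nonpositive<positive : ∀ m {p} → ℤ.- + m ℤ.< + suc p
  nonpositive<positive zero    = ℤ.+<+ (s≤s z≤n)
  nonpositive<positive (suc m) = ℤ.-<+

windowValue : ∀ (i : Fin n) t → t < toℕ i → ∃ λ v → toℕ v + suc t ≡ toℕ i
windowValue i t t<i =
  fromℕ< (≤-<-trans (m∸n≤m (toℕ i) (suc t)) (toℕ<n i)) ,
  trans (cong (_+ suc t) (toℕ-fromℕ< _)) (m∸n+n≡m t<i)

windowValue-< : ∀ {v i : Fin n} t → toℕ v + suc t ≡ toℕ i → toℕ v < toℕ i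
windowValue-< {v = v} t eq = subst (toℕ v <_) eq (m<m+n (toℕ v) (s≤s z≤n))

windowValue-+k : ∀ {v i : Fin n} t → toℕ v + suc t ≡ toℕ i → suc t < k → toℕ i < toℕ v + k
windowValue-+k {v = v} t eq t+1<k = subst (_< toℕ v + _) eq (+-monoʳ-< (toℕ v) t+1<k)

windowIndex : ∀ {v i : Fin n} → toℕ v < toℕ i → toℕ i < toℕ v + k →
              ∃ λ t → suc t < k × toℕ v + suc t ≡ toℕ i
windowIndex {k = k} {v = v} {i} v<i i<v+k =
  t , +-cancelˡ-< (toℕ v) (suc t) k (subst (_< toℕ v + k) (sym eq) i<v+k) , eq
  where
  t = toℕ i ∸ suc (toℕ v)
  eq : toℕ v + suc t ≡ toℕ i
  eq = trans (+-comm (toℕ v) (suc t)) (trans (sym (+-suc t (toℕ v))) (m∸n+n≡m v<i))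

m<n∸1⇔1+m<n : ∀ {m n} → m < n ∸ 1 ⇔ suc m < n
m<n∸1⇔1+m<n {n = zero}  = mk⇔ (λ ()) (λ ())
m<n∸1⇔1+m<n {n = suc n} = mk⇔ s<s s<s⁻¹

≡[]-windowExchange : σ ≡[ k ] τ → ∀ {b : Fin n} t → t < k ∸ 1 →
  LeftOf σ b (windowEntry b t) → ¬ LeftOf τ b (windowEntry b t) →
  ∃ λ t′ → t′ < k ∸ 1 × LeftOf τ b (windowEntry b t′) × ¬ LeftOf σ b (windowEntry b t′)
≡[]-windowExchange {σ = σ} {k} {τ} σ≡τ {b} t t<k∸1 σleft ¬τleft
  with find (Anyₚ.map⁻ (length-filter-exchange (leftOf? σ b) (leftOf? τ b) (window k b)
         (suc-injective (σ≡τ b)) (Anyₚ.map⁺ (lose (∈-upTo⁺ t<k∸1) (σleft , ¬τleft)))))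
... | t′ , t′∈ , τleft , ¬σleft = t′ , ∈-upTo⁻ t′∈ , τleft , ¬σleft

≡[]-exchange : σ ≡[ k ] τ → ∀ {a b : Fin n} → toℕ a < toℕ b → toℕ b < toℕ a + k →
  Before σ a b → ¬ Before τ a b →
  ∃ λ c → toℕ c < toℕ b × toℕ b < toℕ c + k × Before τ c b × Before σ b c
≡[]-exchange {σ = σ} {k} {τ} σ≡τ {a} {b} a<b b<a+k σab ¬τab
  with windowIndex a<b b<a+k
... | t , t+1<k , a+t+1≡b
  with ≡[]-windowExchange {k = k} σ≡τ t (from m<n∸1⇔1+m<n t+1<k)
         (from (leftOf-inside σ t a+t+1≡b) σab) (¬τab ∘ to (leftOf-inside τ t a+t+1≡b))
... | t′ , t′<k∸1 , τleft , ¬σleft with toℕ b ℕ.≤? t′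
...   | yes b≤t′ = contradiction (leftOf-outside σ t′ b≤t′) ¬σleft
...   | no b≰t′ with windowValue b t′ (≰⇒> b≰t′)
...     | c , c+t′+1≡b =
  c , c<b , windowValue-+k t′ c+t′+1≡b (to m<n∸1⇔1+m<n t′<k∸1) ,
  to (leftOf-inside τ t′ c+t′+1≡b) τleft ,
  before-connex σ (λ { refl → <-irrefl refl c<b }) (¬σleft ∘ from (leftOf-inside σ t′ c+t′+1≡b))
  where
  c<b : toℕ c < toℕ b
  c<b = windowValue-< t′ c+t′+1≡b

NearBelow : ℕ → ℕ → Fin n → Fin n → Set
NearBelow k m u v = toℕ u < m × toℕ v < m × Near k u v

nearBelow-sym : ∀ {m} → Symmetric (NearBelow {n} k m)
nearBelow-sym (u<m , v<m , near) = v<m , u<m , near-sym near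

≡[]⇒keepsNearOrder-top : ∀ {m} {a b : Fin n} → σ ≡[ k ] τ → KeepsOrderOn (NearBelow k m) σ τ →
  toℕ b ≡ m → toℕ a < m → Near k a b → Before σ a b → Before τ a b
≡[]⇒keepsNearOrder-top {σ = σ} {k} {τ} {a = a} {b} σ≡τ keep refl a<b (_ , b<a+k) σab
  with pos τ a ℕ.<? pos τ b
... | yes τab = τab
... | no ¬τab with ≡[]-exchange σ≡τ a<b b<a+k σab ¬τab
...   | c , c<b , b<c+k , τcb , σbc =
  contradiction (<-trans (keep a c nearBelow (<-trans σab σbc)) τcb) ¬τab
  where
  nearBelow : NearBelow k (toℕ b) a c
  nearBelow = a<b , c<b , <-trans a<b b<c+k , <-trans c<b b<a+k

≡[]⇒keepsNearOrderBelow : σ ≡[ k ] τ → ∀ m → KeepsOrderOn (NearBelow k m) σ τ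
≡[]⇒keepsNearOrderBelow σ≡τ zero u v (() , _)
≡[]⇒keepsNearOrderBelow {σ = σ} {k} {τ} σ≡τ (suc m) u v (u<1+m , v<1+m , near) σuv
  with m<1+n⇒m<n∨m≡n u<1+m | m<1+n⇒m<n∨m≡n v<1+m
... | inj₁ u<m | inj₁ v<m = ≡[]⇒keepsNearOrderBelow σ≡τ m u v (u<m , v<m , near) σuv
... | inj₁ u<m | inj₂ v≡m =
  ≡[]⇒keepsNearOrder-top σ≡τ (≡[]⇒keepsNearOrderBelow σ≡τ m) v≡m u<m near σuv
... | inj₂ u≡m | inj₁ v<m = before-transfer σ τ
  (≡[]⇒keepsNearOrder-top τ≡σ (≡[]⇒keepsNearOrderBelow τ≡σ m) u≡m v<m (near-sym near)) σuv
  where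
  τ≡σ : τ ≡[ k ] σ
  τ≡σ = ≡[]-sym {k = k} σ≡τ
... | inj₂ u≡m | inj₂ v≡m =
  contradiction σuv (<-irrefl (cong (pos σ) (toℕ-injective (trans u≡m (sym v≡m)))))

≡[]⇒keepsNearOrder : ∀ {k n} {σ τ : Perm n} → σ ≡[ k ] τ → KeepsNearOrder k σ τ
≡[]⇒keepsNearOrder {n = n} σ≡τ u v near =
  ≡[]⇒keepsNearOrderBelow σ≡τ n u v (toℕ<n u , toℕ<n v , near)

keepsNearOrder⇒≡[] : ∀ {k n} {σ τ : Perm n} → KeepsNearOrder k σ τ → σ ≡[ k ] τ
keepsNearOrder⇒≡[] {k} {σ = σ} {τ} keep i =
  cong suc (length-filter-cong (leftOf? σ i) (leftOf? τ i)
                               (Allₚ.map⁺ (All.map agree (Allₚ.all-upTo (k ∸ 1)))))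
  where
  agree : ∀ {t} → t < k ∸ 1 → LeftOf σ i (windowEntry i t) ⇔ LeftOf τ i (windowEntry i t)
  agree {t} t<k∸1 with toℕ i ℕ.≤? t
  ... | yes i≤t = mk⇔ (λ _ → leftOf-outside τ t i≤t) (λ _ → leftOf-outside σ t i≤t)
  ... | no i≰t with windowValue i t (≰⇒> i≰t)
  ...   | v , v+t+1≡i =
    mk⇔ (from (inside τ) ∘ keep v i near ∘ to (inside σ))
        (from (inside σ) ∘ keepsOrderOn-sym {σ = σ} {τ} near-sym keep v i near ∘ to (inside τ))
    where
    inside : ∀ π → LeftOf π i (windowEntry i t) ⇔ Before π v i
    inside π = leftOf-inside π t v+t+1≡i
    near : Near k v i
    near = near-< (windowValue-< t v+t+1≡i) (windowValue-+k t v+t+1≡i (to m<n∸1⇔1+m<n t<k∸1))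

transpose-matchˡ : ∀ (i j : Fin n) → PC.transpose i j i ≡ j
transpose-matchˡ i j rewrite dec-true (i Fin.≟ i) refl = refl

transpose-matchʳ : ∀ (i j : Fin n) → PC.transpose i j j ≡ i
transpose-matchʳ i j with j Fin.≟ i
... | yes refl = refl
... | no j≢i rewrite dec-true (j Fin.≟ j) refl = refl

transpose-other : ∀ (i j : Fin n) {p} → p ≢ i → p ≢ j → PC.transpose i j p ≡ p
transpose-other i j {p} p≢i p≢j rewrite dec-false (p Fin.≟ i) p≢i | dec-false (p Fin.≟ j) p≢j = refl

module _ {i j : Fin n} (j≡1+i : toℕ j ≡ suc (toℕ i)) where

  private
    i<j : toℕ i < toℕ j
    i<j = subst (toℕ i <_) (sym j≡1+i) (n<1+n (toℕ i))

  transpose-adjacent-< : ∀ {p q} → toℕ p < toℕ q → ¬ (p ≡ i × q ≡ j) →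
                         toℕ (PC.transpose j i p) < toℕ (PC.transpose j i q)
  transpose-adjacent-< {p} {q} p<q ¬[p≡i×q≡j] =
    byCases (q Fin.≟ i) (q Fin.≟ j) (p Fin.≟ i) (p Fin.≟ j)
    where
    byCases : Dec (q ≡ i) → Dec (q ≡ j) → Dec (p ≡ i) → Dec (p ≡ j) →
              toℕ (PC.transpose j i p) < toℕ (PC.transpose j i q)
    byCases (yes refl) _ _ _
      rewrite transpose-other j q {p} (<⇒≢ (<-trans p<q i<j) ∘ cong toℕ) (<⇒≢ p<q ∘ cong toℕ)
            | transpose-matchʳ j q = <-trans p<q i<j
    byCases (no _) (yes refl) _ _
      rewrite transpose-other q i {p} (<⇒≢ p<q ∘ cong toℕ) (λ p≡i → ¬[p≡i×q≡j] (p≡i , refl))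
            | transpose-matchˡ q i =
      ≤∧≢⇒< (s≤s⁻¹ (subst (toℕ p <_) j≡1+i p<q))
            (λ p≡i → ¬[p≡i×q≡j] (toℕ-injective p≡i , refl))
    byCases (no q≢i) (no q≢j) (yes refl) _
      rewrite transpose-other j p q≢j q≢i | transpose-matchʳ j p =
      ≤∧≢⇒< (subst (_≤ toℕ q) (sym j≡1+i) p<q) (q≢j ∘ sym ∘ toℕ-injective)
    byCases (no q≢i) (no q≢j) (no _) (yes refl)
      rewrite transpose-other p i q≢j q≢i | transpose-matchˡ p i = <-trans i<j p<q
    byCases (no q≢i) (no q≢j) (no p≢i) (no p≢j)
      rewrite transpose-other j i q≢j q≢i | transpose-other j i p≢j p≢i = p<q

swap-adjacent : ∀ (ω : Perm n) {x y} → pos ω y ≡ suc (pos ω x) → ¬ Near k x y →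
                ∃ λ ω′ → ω′ ≡[ k ] ω × Before ω′ y x
swap-adjacent {k = k} ω {x} {y} y≡1+x ¬near = ω′ , ≡[]-sym {k = k} (keepsNearOrder⇒≡[] keep) , ω′yx
  where
  i = ω ⟨$⟩ˡ x
  j = ω ⟨$⟩ˡ y
  ω′ : Perm _
  ω′ = transpose i j ∘ₚ ω
  ω′yx : Before ω′ y x
  ω′yx rewrite transpose-matchˡ j i | transpose-matchʳ j i = subst (pos ω x <_) (sym y≡1+x) (n<1+n _)
  keep : KeepsNearOrder k ω ω′
  keep u v near ωuv = transpose-adjacent-< y≡1+x ωuv λ (u≡x , v≡y) →
    ¬near (subst₂ (Near k) (pos-injective ω (cong toℕ u≡x)) (pos-injective ω (cong toℕ v≡y)) near)

IsClassMaximum : ℕ → Perm n → Perm n → Set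
IsClassMaximum k ρ ω = ω ≡[ k ] ρ × (∀ σ → σ ≡[ k ] ρ → σ ≤R ω)

IsClassMinimum : ℕ → Perm n → Perm n → Set
IsClassMinimum k ρ α = α ≡[ k ] ρ × (∀ σ → σ ≡[ k ] ρ → α ≤R σ)

classMaximum-ascents-near : IsClassMaximum k ρ ω → ∀ {x y} → pos ω y ≡ suc (pos ω x) →
                            toℕ x < toℕ y → toℕ y < toℕ x + k
classMaximum-ascents-near {k = k} {ρ = ρ} {ω = ω} (ω≡ρ , maximal) {x} {y} y≡1+x x<y with toℕ y ℕ.<? toℕ x + k
... | yes y<x+k = y<x+k
... | no y≮x+k with swap-adjacent ω y≡1+x (y≮x+k ∘ proj₂)
...   | ω′ , ω′≡ω , ω′yx =
  contradiction (subst (_< pos ω x) y≡1+x (proj₂ (maximal ω′ ω′≡ρ x y (x<y , ω′yx)))) (<-asym (n<1+n _))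
  where
  ω′≡ρ : ω′ ≡[ k ] ρ
  ω′≡ρ = ≡[]-trans {k = k} ω′≡ω ω≡ρ

classMinimum-descents-near : IsClassMinimum k ρ α → ∀ {x y} → pos α y ≡ suc (pos α x) →
                             toℕ y < toℕ x → toℕ x < toℕ y + k
classMinimum-descents-near {k = k} {ρ = ρ} {α = α} (α≡ρ , minimal) {x} {y} y≡1+x y<x with toℕ x ℕ.<? toℕ y + k
... | yes x<y+k = x<y+k
... | no x≮y+k with swap-adjacent α y≡1+x (x≮y+k ∘ proj₁)
...   | α′ , α′≡α , α′yx =
  contradiction (proj₂ (minimal α′ α′≡ρ y x (y<x , αxy))) (<-asym α′yx)
  where
  α′≡ρ : α′ ≡[ k ] ρ
  α′≡ρ = ≡[]-trans {k = k} α′≡α α≡ρ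
  αxy : Before α x y
  αxy = subst (pos α x <_) (sym y≡1+x) (n<1+n _)

-- key relabels the values: toℕ for class maxima, mirror (turning descents into ascents) for minima.
module _ (k : ℕ) (ω τ : Perm n)
         (key : Fin n → ℕ) (key-injective : ∀ {u v} → key u ≡ key v → u ≡ v)
         (ascents-near : ∀ x y → pos ω y ≡ suc (pos ω x) → key x < key y → key y < key x + k)
         (nearRises-kept : ∀ x y → key x < key y → key y < key x + k → Before ω x y → Before τ x y)
         where

  private
    -- Scanning ω rightwards from x, the first value whose key exceeds key a is preceded by an
    -- ascent, so its key lies within k of key a.
    nearRise : ∀ d {a b x} → pos ω b ≤ d + pos ω x → pos ω a ≤ pos ω x → key x ≤ key a →
               pos ω x < pos ω b → key a < key b →
               ∃ λ c → Before ω a c × pos ω c ≤ pos ω b × key a < key c × key c < key a + k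
    nearRise zero b≤x _ _ x<b _ = contradiction b≤x (<⇒≱ x<b)
    nearRise (suc d) {a} {b} {x} b≤1+d+x a≤x kx≤ka x<b ka<kb
      with valueAt ω (suc (pos ω x)) (≤-<-trans x<b (pos<n ω b))
    ... | y , y≡1+x with key a ℕ.<? key y
    ...   | yes ka<ky =
      y , subst (pos ω a <_) (sym y≡1+x) (s≤s a≤x) , y≤b , ka<ky ,
      <-≤-trans (ascents-near x y y≡1+x (≤-<-trans kx≤ka ka<ky)) (+-monoˡ-≤ k kx≤ka)
      where
      y≤b : pos ω y ≤ pos ω b
      y≤b = subst (_≤ pos ω b) (sym y≡1+x) x<b
    ...   | no ka≮ky = nearRise d b≤d+y a≤y (≮⇒≥ ka≮ky) y<b ka<kb
      where
      b≤d+y : pos ω b ≤ d + pos ω y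
      b≤d+y = subst (pos ω b ≤_) (trans (sym (+-suc d (pos ω x))) (cong (λ p → d + p) (sym y≡1+x))) b≤1+d+x
      a≤y : pos ω a ≤ pos ω y
      a≤y = subst (pos ω a ≤_) (sym y≡1+x) (m≤n⇒m≤1+n a≤x)
      y<b : pos ω y < pos ω b
      y<b = ≤∧≢⇒< (subst (_≤ pos ω b) (sym y≡1+x) x<b)
                  (λ y≡b → <-irrefl (cong key (pos-injective ω y≡b)) (≤-<-trans (≮⇒≥ ka≮ky) ka<kb))

    keepsAscendingWithin : ∀ g {a b} → key b ≤ g + key a → key a < key b → Before ω a b → Before τ a b
    keepsAscendingWithin zero kb≤ka ka<kb _ = contradiction kb≤ka (<⇒≱ ka<kb)
    keepsAscendingWithin (suc g) {a} {b} kb≤1+g+ka ka<kb ωab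
      with nearRise n (≤-trans (<⇒≤ (pos<n ω b)) (m≤m+n n (pos ω a))) ≤-refl ≤-refl ωab ka<kb
    ... | c , ωac , c≤b , ka<kc , kc<ka+k with <-cmp (key c) (key b)
    ...   | tri< kc<kb _ _ =
      <-trans (nearRises-kept a c ka<kc kc<ka+k ωac) (keepsAscendingWithin g kb≤g+kc kc<kb ωcb)
      where
      kb≤g+kc : key b ≤ g + key c
      kb≤g+kc = ≤-trans kb≤1+g+ka (subst (_≤ g + key c) (+-suc g (key a)) (+-monoʳ-≤ g ka<kc))
      ωcb : Before ω c b
      ωcb = ≤∧≢⇒< c≤b (λ c≡b → <-irrefl (cong key (pos-injective ω c≡b)) kc<kb)
    ...   | tri≈ _ kc≡kb _ = subst (Before τ a) (key-injective kc≡kb) (nearRises-kept a c ka<kc kc<ka+k ωac)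
    ...   | tri> _ _ kb<kc = nearRises-kept a b ka<kb (<-trans kb<kc kc<ka+k) ωab

  keepsAscending : ∀ a b → key a < key b → Before ω a b → Before τ a b
  keepsAscending a b = keepsAscendingWithin (key b) (m≤m+n (key b) (key a))

mirror : Fin n → ℕ
mirror v = toℕ (opposite v)

mirror-< : ∀ {u v : Fin n} → toℕ u < toℕ v → mirror v < mirror u
mirror-< {u = u} {v} u<v rewrite opposite-prop u | opposite-prop v = ∸-monoʳ-< (s<s u<v) (toℕ<n v)

mirror-<⁻¹ : ∀ {u v : Fin n} → mirror v < mirror u → toℕ u < toℕ v
mirror-<⁻¹ {u = u} {v} mv<mu with <-cmp (toℕ u) (toℕ v)
... | tri< u<v _ _ = u<v
... | tri≈ _ u≡v _ = contradiction (cong mirror (toℕ-injective u≡v)) (<⇒≢ mv<mu ∘ sym)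
... | tri> _ _ v<u = contradiction (mirror-< v<u) (<-asym mv<mu)

mirror-injective : ∀ {u v : Fin n} → mirror u ≡ mirror v → u ≡ v
mirror-injective {u = u} {v} mu≡mv =
  trans (sym (opposite-involutive u)) (trans (cong opposite (toℕ-injective mu≡mv)) (opposite-involutive v))

mirror-gap : ∀ {n} {u v : Fin n} → toℕ u ≤ toℕ v → mirror u ≡ mirror v + (toℕ v ∸ toℕ u)
mirror-gap {n} {u} {v} u≤v = begin
  toℕ (opposite u)                            ≡⟨ opposite-prop u ⟩
  n ∸ suc (toℕ u)                             ≡⟨ cong (_∸ suc (toℕ u)) (m∸n+n≡m (toℕ<n v)) ⟨
  (n ∸ suc (toℕ v)) + suc (toℕ v) ∸ suc (toℕ u) ≡⟨ +-∸-assoc (n ∸ suc (toℕ v)) (s≤s u≤v) ⟩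
  (n ∸ suc (toℕ v)) + (toℕ v ∸ toℕ u)         ≡⟨ cong (_+ (toℕ v ∸ toℕ u)) (opposite-prop v) ⟨
  toℕ (opposite v) + (toℕ v ∸ toℕ u)          ∎
  where open ≡-Reasoning

+-cancelˡ-<-⇔ : ∀ m {a b} → m + a < m + b ⇔ a < b
+-cancelˡ-<-⇔ m {a} {b} = mk⇔ (+-cancelˡ-< m a b) (+-monoʳ-< m)

mirror-near : ∀ {u v : Fin n} → toℕ u ≤ toℕ v → toℕ v < toℕ u + k ⇔ mirror u < mirror v + k
mirror-near {k = k} {u = u} {v} u≤v =
  subst₂ (λ a b → a < toℕ u + k ⇔ b < mirror v + k) (m+[n∸m]≡n u≤v) (sym (mirror-gap u≤v))
         (⇔-sym (+-cancelˡ-<-⇔ (mirror v)) ⇔-∘ +-cancelˡ-<-⇔ (toℕ u))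

id-≤R : ∀ (τ : Perm n) → id ≤R τ
id-≤R τ a b (a<b , b<a) = contradiction b<a (<-asym a<b)

≤R-reverse : ∀ (τ : Perm n) → τ ≤R reverse
≤R-reverse τ a b (a<b , _) = a<b , mirror-< a<b

classMaximum-lowerSet-closed : IsClassMaximum k ρ ω → σ ≤R ω → σ ≡[ k ] τ → τ ≤R ω
classMaximum-lowerSet-closed {k = k} {ω = ω} {σ = σ} {τ} max σ≤ω σ≡τ a b (a<b , τba) =
  a<b , before-transfer τ ω (keepsAscending k ω τ toℕ toℕ-injective ascents-near nearRises-kept a b a<b)
                            τba
  where
  ascents-near : ∀ x y → pos ω y ≡ suc (pos ω x) → toℕ x < toℕ y → toℕ y < toℕ x + k
  ascents-near x y = classMaximum-ascents-near max
  nearRises-kept : ∀ x y → toℕ x < toℕ y → toℕ y < toℕ x + k → Before ω x y → Before τ x y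
  nearRises-kept x y x<y y<x+k ωxy = ≡[]⇒keepsNearOrder σ≡τ x y (near-< x<y y<x+k)
    (before-transfer ω σ (λ σyx → proj₂ (σ≤ω x y (x<y , σyx))) ωxy)

classMinimum-upperSet-closed : IsClassMinimum k ρ α → α ≤R σ → σ ≡[ k ] τ → α ≤R τ
classMinimum-upperSet-closed {k = k} {α = α} {σ = σ} {τ} min α≤σ σ≡τ a b (a<b , αba) =
  a<b , keepsAscending k α τ mirror mirror-injective ascents-near nearRises-kept b a (mirror-< a<b) αba
  where
  ascents-near : ∀ x y → pos α y ≡ suc (pos α x) → mirror x < mirror y → mirror y < mirror x + k
  ascents-near x y y≡1+x mx<my =
    to (mirror-near (<⇒≤ (mirror-<⁻¹ mx<my))) (classMinimum-descents-near min y≡1+x (mirror-<⁻¹ mx<my))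
  nearRises-kept : ∀ x y → mirror x < mirror y → mirror y < mirror x + k → Before α x y → Before τ x y
  nearRises-kept x y mx<my my<mx+k αxy = ≡[]⇒keepsNearOrder σ≡τ x y
    (near-sym (near-< y<x (from (mirror-near (<⇒≤ y<x)) my<mx+k))) (proj₂ (α≤σ y x (y<x , αxy)))
    where
    y<x : toℕ y < toℕ x
    y<x = mirror-<⁻¹ mx<my

mainTheorem4 : (k : ℕ) → k ≥ 1 → (n : ℕ) →
    ((ρ ω : Perm n) → ω ≡[ k ] ρ → (∀ σ → σ ≡[ k ] ρ → σ ≤R ω) →
      ∀ σ τ → (id ≤R σ × σ ≤R ω) → σ ≡[ k ] τ → (id ≤R τ × τ ≤R ω))
    × ((ρ α : Perm n) → α ≡[ k ] ρ → (∀ σ → σ ≡[ k ] ρ → α ≤R σ) →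
      ∀ σ τ → (α ≤R σ × σ ≤R reverse) → σ ≡[ k ] τ → (α ≤R τ × τ ≤R reverse))
mainTheorem4 k _ n =
  (λ ρ ω ω≡ρ maximal σ τ (_ , σ≤ω) σ≡τ →
     id-≤R τ , classMaximum-lowerSet-closed {k = k} (ω≡ρ , maximal) σ≤ω σ≡τ) ,
  (λ ρ α α≡ρ minimal σ τ (α≤σ , _) σ≡τ →
     classMinimum-upperSet-closed {k = k} (α≡ρ , minimal) α≤σ σ≡τ , ≤R-reverse τ)
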